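{- Let $q$ be a prime power and let $n \geq 5$ be an integer. Then ${\rm PSL}_2(q)$ admits no string representation of rank $n$. Equivalently, there is no reflexible maniplex of rank $n$ whose automorphism group is isomorphic to ${\rm PSL}_2(q)$.
   Context: A group $G$ is a string group generated by involutions if it is generated by involutions $g_0,\ldots,g_{n-1}$ with $g_ig_j=g_jg_i$ whenever $|i-j|>1$. If these $n$ involutions are pairwise distinct, the $n$-tuple $(g_0,\ldots,g_{n-1})$ is called a string representation of $G$ of rank $n$. A reflexible maniplex of rank $n$ with automorphism group $G$ corresponds exactly to a string representation of $G$ of rank $n$: given such a representation $(\rho_0,\ldots,\rho_{n-1})$, the flags are the elements of $G$, the distinguished involutions act by left multiplication by $\rho_i$, and the automorphism group (acting by right multiplication) is $G$; conversely every reflexible $n$-maniplex yields such a representation of its automorphism group. -}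

module Defs where

open import Level using (Level; _⊔_)
import Data.Nat as N
open import Data.Nat using (ℕ)
open import Data.Nat.Primality using (Prime)
open import Data.Fin using (Fin; toℕ)
open import Data.List using (List; foldr)
open import Data.Product using (Σ; ∃; _×_; _,_)
open import Data.Sum using (_⊎_)
open import Relation.Nullary using (¬_)
open import Relation.Binary.PropositionalEquality using (_≡_)
open import Algebra.Bundles using (CommutativeRing)

IsPrimePower : ℕ → Set
IsPrimePower q = Σ ℕ λ p → Σ ℕ λ k → Prime p × (1 N.≤ k) × (q ≡ p N.^ k)

module _ {c ℓ : Level} (R : CommutativeRing c ℓ) where
  open CommutativeRing R

  IsField : Set (c ⊔ ℓ)
  IsField = (¬ (1# ≈ 0#)) × (∀ x → ¬ (x ≈ 0#) → Σ Carrier λ y → x * y ≈ 1#)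

  HasSize : ℕ → Set (c ⊔ ℓ)
  HasSize q = Σ (Fin q → Carrier) λ f →
                (∀ i j → f i ≈ f j → i ≡ j) × (∀ x → Σ (Fin q) λ i → f i ≈ x)

  record Mat : Set c where
    constructor mat
    field
      m₁₁ m₁₂ m₂₁ m₂₂ : Carrier
  open Mat public

  det : Mat → Carrier
  det M = m₁₁ M * m₂₂ M - m₁₂ M * m₂₁ M

  I₂ : Mat
  I₂ = mat 1# 0# 0# 1#

  _·_ : Mat → Mat → Mat
  A · B = mat (m₁₁ A * m₁₁ B + m₁₂ A * m₂₁ B) (m₁₁ A * m₁₂ B + m₁₂ A * m₂₂ B)
              (m₂₁ A * m₁₁ B + m₂₂ A * m₂₁ B) (m₂₁ A * m₁₂ B + m₂₂ A * m₂₂ B)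

  neg : Mat → Mat
  neg A = mat (- m₁₁ A) (- m₁₂ A) (- m₂₁ A) (- m₂₂ A)

  _≈M_ : Mat → Mat → Set ℓ
  A ≈M B = (m₁₁ A ≈ m₁₁ B) × (m₁₂ A ≈ m₁₂ B) × (m₂₁ A ≈ m₂₁ B) × (m₂₂ A ≈ m₂₂ B)

  -- PSL₂(R) = SL₂(R)/{±I}: elements are matrices of determinant 1,
  -- and two of them are equal in PSL₂ iff A = B or A = -B.
  InSL2 : Mat → Set ℓ
  InSL2 A = det A ≈ 1#

  _≈P_ : Mat → Mat → Set ℓ
  A ≈P B = (A ≈M B) ⊎ (A ≈M neg B)

  wordProd : {n : ℕ} → (Fin n → Mat) → List (Fin n) → Mat
  wordProd g = foldr (λ i M → g i · M) I₂

  record StringRep (n : ℕ) : Set (c ⊔ ℓ) where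
    field
      gen        : Fin n → Mat
      gen-SL2    : ∀ i → InSL2 (gen i)
      involution : ∀ i → (gen i · gen i) ≈P I₂
      nontrivial : ∀ i → ¬ (gen i ≈P I₂)
      distinct   : ∀ i j → gen i ≈P gen j → i ≡ j
      string     : ∀ i j → toℕ i N.+ 2 N.≤ toℕ j → (gen i · gen j) ≈P (gen j · gen i)
      generates  : ∀ A → InSL2 A → Σ (List (Fin n)) λ w → wordProd gen w ≈P A

{-# OPTIONS --safe #-}
-- An involution of PSL₂(F) lifts to a traceless matrix X with X² = -I, and two
-- lifts commute in PSL₂(F) iff they commute or anticommute as matrices.
-- If 2 is invertible, X Y + Y X = ⟨ X , Y ⟩ I for a polar form ⟨_,_⟩ of det on
-- the 3-dimensional space of traceless matrices, and commuting lifts are equal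
-- up to sign, so non-adjacent generators of a string are orthogonal: five of
-- them do not fit in three dimensions. In characteristic 2, commuting in PSL₂(F)
-- makes the off-diagonal parts of two lifts proportional, which links every
-- generator to ρ₀ (ρ₁ through ρ₃), so all generators commute, whereas PSL₂(F)
-- is not abelian.
module Submission where

open import Level using (Level)
open import Algebra.Bundles using (CommutativeRing)
open import Data.Nat as ℕ using (ℕ; _≤_; s≤s; z≤n)
import Data.Nat.Properties as ℕ
open import Data.Integer as ℤ using (ℤ; +_; -[1+_])
import Data.Integer.Properties as ℤ
open import Data.Sign as Sign using (Sign)
open import Data.Maybe using (Maybe; just; nothing)
open import Data.Product using (Σ; _×_; _,_; proj₁; proj₂)
open import Data.Sum using (_⊎_; inj₁; inj₂)
open import Data.Empty using (⊥; ⊥-elim)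
open import Data.Fin as Fin using (Fin; toℕ; #_; zero; suc)
open import Data.List using (List; []; _∷_)
open import Relation.Nullary using (¬_; Dec; yes; no)
open import Relation.Nullary.Decidable using (True; toWitness)
open import Relation.Binary.Bundles using (Setoid)
open import Relation.Binary.Structures using (IsEquivalence)
open import Relation.Binary.PropositionalEquality as ≡ using (_≡_; _≢_)
import Relation.Binary.Reasoning.Setoid
open import Algebra.Solver.Ring.AlmostCommutativeRing
  using (_-Raw-AlmostCommutative⟶_; fromCommutativeRing)
open import Defs

-- The ring solver needs a coefficient ring with decidable equality;
-- ℤ, mapped into F by its unique ring morphism, serves as one.
module IntegerCoefficientSolver {c ℓ : Level} (F : CommutativeRing c ℓ) where
  open CommutativeRing F
  open import Relation.Binary.Reasoning.Setoid setoid
  open import Algebra.Properties.Ring ring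
    using (-‿distribˡ-*; -‿distribʳ-*)
  open import Algebra.Properties.Group +-group
    using (⁻¹-involutive; ε⁻¹≈ε; ⁻¹-anti-homo-∙)
  open import Algebra.Properties.Semiring.Mult.TCOptimised semiring
    using (×-homo-+; ×1-homo-*; 1+×) renaming (_×_ to _×ₙ_)

  private
    ⟦_⟧ : ℤ → Carrier
    ⟦ + n ⟧      = n ×ₙ 1#
    ⟦ -[1+ n ] ⟧ = - (ℕ.suc n ×ₙ 1#)

    signed : Sign → Carrier → Carrier
    signed Sign.+ x = x
    signed Sign.- x = - x

    signed-cong : ∀ s {x y} → x ≈ y → signed s x ≈ signed s y
    signed-cong Sign.+ x≈y = x≈y
    signed-cong Sign.- x≈y = -‿cong x≈y

    signed-* : ∀ s t x y → signed (s Sign.* t) (x * y) ≈ signed s x * signed t y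
    signed-* Sign.+ Sign.+ x y = refl
    signed-* Sign.+ Sign.- x y = -‿distribʳ-* x y
    signed-* Sign.- Sign.+ x y = -‿distribˡ-* x y
    signed-* Sign.- Sign.- x y = begin
      x * y         ≈⟨ ⁻¹-involutive _ ⟨
      - - (x * y)   ≈⟨ -‿cong (-‿distribˡ-* x y) ⟩
      - (- x * y)   ≈⟨ -‿distribʳ-* (- x) y ⟩
      - x * - y     ∎

    ⟦⟧-signAbs : ∀ i → ⟦ i ⟧ ≈ signed (ℤ.sign i) (ℤ.∣ i ∣ ×ₙ 1#)
    ⟦⟧-signAbs (+ n)    = refl
    ⟦⟧-signAbs -[1+ n ] = refl

    ⟦◃⟧ : ∀ s n → ⟦ s ℤ.◃ n ⟧ ≈ signed s (n ×ₙ 1#)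
    ⟦◃⟧ Sign.+ ℕ.zero    = refl
    ⟦◃⟧ Sign.- ℕ.zero    = sym ε⁻¹≈ε
    ⟦◃⟧ Sign.+ (ℕ.suc n) = refl
    ⟦◃⟧ Sign.- (ℕ.suc n) = refl

    *-homo : ∀ i j → ⟦ i ℤ.* j ⟧ ≈ ⟦ i ⟧ * ⟦ j ⟧
    *-homo i j = begin
      ⟦ s ℤ.◃ ℤ.∣ i ∣ ℕ.* ℤ.∣ j ∣ ⟧                 ≈⟨ ⟦◃⟧ s (ℤ.∣ i ∣ ℕ.* ℤ.∣ j ∣) ⟩
      signed s ((ℤ.∣ i ∣ ℕ.* ℤ.∣ j ∣) ×ₙ 1#)        ≈⟨ signed-cong s (×1-homo-* ℤ.∣ i ∣ ℤ.∣ j ∣) ⟩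
      signed s ((ℤ.∣ i ∣ ×ₙ 1#) * (ℤ.∣ j ∣ ×ₙ 1#))   ≈⟨ signed-* (ℤ.sign i) (ℤ.sign j) _ _ ⟩
      signed (ℤ.sign i) (ℤ.∣ i ∣ ×ₙ 1#) * signed (ℤ.sign j) (ℤ.∣ j ∣ ×ₙ 1#)
                                                    ≈⟨ *-cong (⟦⟧-signAbs i) (⟦⟧-signAbs j) ⟨
      ⟦ i ⟧ * ⟦ j ⟧                                 ∎
      where s = ℤ.sign i Sign.* ℤ.sign j

    ⟦⊖⟧ : ∀ m n → ⟦ m ℤ.⊖ n ⟧ ≈ m ×ₙ 1# - n ×ₙ 1#
    ⟦⊖⟧ m       ℕ.zero    = begin
      m ×ₙ 1#          ≈⟨ +-identityʳ _ ⟨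
      m ×ₙ 1# + 0#     ≈⟨ +-congˡ ε⁻¹≈ε ⟨
      m ×ₙ 1# - 0#     ∎
    ⟦⊖⟧ ℕ.zero    (ℕ.suc n) = sym (+-identityˡ _)
    ⟦⊖⟧ (ℕ.suc m) (ℕ.suc n) = begin
      ⟦ ℕ.suc m ℤ.⊖ ℕ.suc n ⟧                 ≡⟨ ≡.cong ⟦_⟧ (ℤ.[1+m]⊖[1+n]≡m⊖n m n) ⟩
      ⟦ m ℤ.⊖ n ⟧                         ≈⟨ ⟦⊖⟧ m n ⟩
      a - b                               ≈⟨ +-congʳ (+-identityˡ a) ⟨
      0# + a - b                          ≈⟨ +-congʳ (+-congʳ (-‿inverseʳ 1#)) ⟨
      1# - 1# + a - b                     ≈⟨ +-congʳ (+-assoc 1# (- 1#) a) ⟩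
      1# + (- 1# + a) - b                 ≈⟨ +-congʳ (+-congˡ (+-comm (- 1#) a)) ⟩
      1# + (a - 1#) - b                   ≈⟨ +-congʳ (+-assoc 1# a (- 1#)) ⟨
      1# + a - 1# - b                     ≈⟨ +-assoc (1# + a) (- 1#) (- b) ⟩
      1# + a + (- 1# - b)                 ≈⟨ +-congˡ (⁻¹-anti-homo-∙ b 1#) ⟨
      1# + a - (b + 1#)                   ≈⟨ +-congˡ (-‿cong (+-comm b 1#)) ⟩
      1# + a - (1# + b)                   ≈⟨ +-cong (1+× m 1#) (-‿cong (1+× n 1#)) ⟨
      ℕ.suc m ×ₙ 1# - ℕ.suc n ×ₙ 1#             ∎
      where a = m ×ₙ 1#; b = n ×ₙ 1#

    +-homo : ∀ i j → ⟦ i ℤ.+ j ⟧ ≈ ⟦ i ⟧ + ⟦ j ⟧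
    +-homo (+ m)    (+ n)    = ×-homo-+ 1# m n
    +-homo (+ m)    -[1+ n ] = ⟦⊖⟧ m (ℕ.suc n)
    +-homo -[1+ m ] (+ n)    = trans (⟦⊖⟧ n (ℕ.suc m)) (+-comm _ _)
    +-homo -[1+ m ] -[1+ n ] = begin
      - (ℕ.suc (ℕ.suc (m ℕ.+ n)) ×ₙ 1#)          ≡⟨ ≡.cong (λ k → - (ℕ.suc k ×ₙ 1#)) (ℕ.+-suc m n) ⟨
      - ((ℕ.suc m ℕ.+ ℕ.suc n) ×ₙ 1#)            ≈⟨ -‿cong (×-homo-+ 1# (ℕ.suc m) (ℕ.suc n)) ⟩
      - (ℕ.suc m ×ₙ 1# + ℕ.suc n ×ₙ 1#)           ≈⟨ -‿cong (+-comm _ _) ⟩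
      - (ℕ.suc n ×ₙ 1# + ℕ.suc m ×ₙ 1#)           ≈⟨ ⁻¹-anti-homo-∙ _ _ ⟩
      - (ℕ.suc m ×ₙ 1#) + - (ℕ.suc n ×ₙ 1#)       ∎

    -‿homo : ∀ i → ⟦ ℤ.- i ⟧ ≈ - ⟦ i ⟧
    -‿homo (+ ℕ.zero)  = sym ε⁻¹≈ε
    -‿homo (+ ℕ.suc n) = refl
    -‿homo -[1+ n ]  = sym (⁻¹-involutive _)

    morphism : ℤ.+-*-rawRing -Raw-AlmostCommutative⟶ fromCommutativeRing F
    morphism = record
      { ⟦_⟧ = ⟦_⟧ ; +-homo = +-homo ; *-homo = *-homo ; -‿homo = -‿homo
      ; 0-homo = refl ; 1-homo = refl }

    ⟦⟧-≟ : ∀ i j → Maybe (⟦ i ⟧ ≈ ⟦ j ⟧)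
    ⟦⟧-≟ i j with i ℤ.≟ j
    ... | yes ≡.refl = just refl
    ... | no _       = nothing

  open import Algebra.Solver.Ring ℤ.+-*-rawRing (fromCommutativeRing F) morphism ⟦⟧-≟ public
    using (solve; _:=_; _:+_; _:*_; _:-_; :-_; con)

module MatrixAlgebra {c ℓ : Level} (F : CommutativeRing c ℓ) where
  open CommutativeRing F
  open IntegerCoefficientSolver F
  open import Algebra.Properties.Group +-group
    using (x≈y⇒x∙y⁻¹≈ε; x∙y⁻¹≈ε⇒x≈y; ⁻¹-involutive; ε⁻¹≈ε)

  -- Polynomial consequences of hypotheses are proved by letting the solver
  -- write x - y as a combination e of differences of hypotheses.
  ≈-from-difference : ∀ {x y} e → x - y ≈ e → e ≈ 0# → x ≈ y
  ≈-from-difference {x} {y} e x-y≈e e≈0 = x∙y⁻¹≈ε⇒x≈y x y (trans x-y≈e e≈0)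

  x-y≈0 : ∀ {x y} → x ≈ y → x - y ≈ 0#
  x-y≈0 = x≈y⇒x∙y⁻¹≈ε

  y*x≈0 : ∀ y {x} → x ≈ 0# → y * x ≈ 0#
  y*x≈0 y x≈0 = trans (*-congˡ x≈0) (zeroʳ y)

  x+y≈0 : ∀ {x y} → x ≈ 0# → y ≈ 0# → x + y ≈ 0#
  x+y≈0 x≈0 y≈0 = trans (+-cong x≈0 y≈0) (+-identityʳ 0#)

  two : Carrier
  two = 1# + 1#

  M : Set c
  M = Mat F

  infixl 7 _⊙_
  infixr 8 _•_
  infixl 6 _⊕_
  infix  4 _≋_ _≈ᴾ_

  _⊙_ : M → M → M
  _⊙_ = _·_ F

  _≋_ : M → M → Set ℓ
  _≋_ = _≈M_ F

  _≈ᴾ_ : M → M → Set ℓ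
  _≈ᴾ_ = _≈P_ F

  -ᴹ_ : M → M
  -ᴹ_ = neg F

  I : M
  I = I₂ F

  _•_ : Carrier → M → M
  s • A = mat (s * m₁₁ A) (s * m₁₂ A) (s * m₂₁ A) (s * m₂₂ A)

  _⊕_ : M → M → M
  A ⊕ B = mat (m₁₁ A + m₁₁ B) (m₁₂ A + m₁₂ B) (m₂₁ A + m₂₁ B) (m₂₂ A + m₂₂ B)

  trace : M → Carrier
  trace A = m₁₁ A + m₂₂ A

  ≋-isEquivalence : IsEquivalence _≋_
  ≋-isEquivalence = record
    { refl  = refl , refl , refl , refl
    ; sym   = λ (a , b , c , d) → sym a , sym b , sym c , sym d
    ; trans = λ (a , b , c , d) (a′ , b′ , c′ , d′) →
                trans a a′ , trans b b′ , trans c c′ , trans d d′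
    }

  ≋-setoid : Setoid c ℓ
  ≋-setoid = record { isEquivalence = ≋-isEquivalence }

  open IsEquivalence ≋-isEquivalence public
    using () renaming (refl to ≋-refl; sym to ≋-sym; trans to ≋-trans)
  module ≋-Reasoning = Relation.Binary.Reasoning.Setoid ≋-setoid

  ⊙-cong : ∀ {A A′ B B′} → A ≋ A′ → B ≋ B′ → A ⊙ B ≋ A′ ⊙ B′
  ⊙-cong (a , b , c , d) (x , y , z , w) =
    +-cong (*-cong a x) (*-cong b z) , +-cong (*-cong a y) (*-cong b w) ,
    +-cong (*-cong c x) (*-cong d z) , +-cong (*-cong c y) (*-cong d w)

  ⊙-congˡ : ∀ {A B B′} → B ≋ B′ → A ⊙ B ≋ A ⊙ B′
  ⊙-congˡ = ⊙-cong ≋-refl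

  ⊙-congʳ : ∀ {A A′ B} → A ≋ A′ → A ⊙ B ≋ A′ ⊙ B
  ⊙-congʳ A≋A′ = ⊙-cong A≋A′ ≋-refl

  -ᴹ-cong : ∀ {A B} → A ≋ B → -ᴹ A ≋ -ᴹ B
  -ᴹ-cong (a , b , c , d) = -‿cong a , -‿cong b , -‿cong c , -‿cong d

  •-cong : ∀ {s t A B} → s ≈ t → A ≋ B → s • A ≋ t • B
  •-cong s≈t (a , b , c , d) = *-cong s≈t a , *-cong s≈t b , *-cong s≈t c , *-cong s≈t d

  ⊕-cong : ∀ {A A′ B B′} → A ≋ A′ → B ≋ B′ → A ⊕ B ≋ A′ ⊕ B′
  ⊕-cong (a , b , c , d) (x , y , z , w) = +-cong a x , +-cong b y , +-cong c z , +-cong d w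

  ⊙-assoc : ∀ A B C → (A ⊙ B) ⊙ C ≋ A ⊙ (B ⊙ C)
  ⊙-assoc (mat a b c d) (mat p q r s) (mat x y z w) =
    entry a b p q r s x z , entry a b p q r s y w , entry c d p q r s x z , entry c d p q r s y w
    where
    entry : ∀ x₁ x₂ y₁₁ y₁₂ y₂₁ y₂₂ z₁ z₂ →
      (x₁ * y₁₁ + x₂ * y₂₁) * z₁ + (x₁ * y₁₂ + x₂ * y₂₂) * z₂ ≈
      x₁ * (y₁₁ * z₁ + y₁₂ * z₂) + x₂ * (y₂₁ * z₁ + y₂₂ * z₂)
    entry = solve 8 (λ x₁ x₂ y₁₁ y₁₂ y₂₁ y₂₂ z₁ z₂ →
      (x₁ :* y₁₁ :+ x₂ :* y₂₁) :* z₁ :+ (x₁ :* y₁₂ :+ x₂ :* y₂₂) :* z₂ :=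
      x₁ :* (y₁₁ :* z₁ :+ y₁₂ :* z₂) :+ x₂ :* (y₂₁ :* z₁ :+ y₂₂ :* z₂)) refl

  ⊙-identityˡ : ∀ A → I ⊙ A ≋ A
  ⊙-identityˡ (mat a b c d) = first a c , first b d , second a c , second b d
    where
    first : ∀ x y → 1# * x + 0# * y ≈ x
    first = solve 2 (λ x y → con (+ 1) :* x :+ con (+ 0) :* y := x) refl
    second : ∀ x y → 0# * x + 1# * y ≈ y
    second = solve 2 (λ x y → con (+ 0) :* x :+ con (+ 1) :* y := y) refl

  ⊙-identityʳ : ∀ A → A ⊙ I ≋ A
  ⊙-identityʳ (mat a b c d) = first a b , second a b , first c d , second c d
    where
    first : ∀ x y → x * 1# + y * 0# ≈ x
    first = solve 2 (λ x y → x :* con (+ 1) :+ y :* con (+ 0) := x) refl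
    second : ∀ x y → x * 0# + y * 1# ≈ y
    second = solve 2 (λ x y → x :* con (+ 0) :+ y :* con (+ 1) := y) refl

  -ᴹ-⊙ : ∀ A B → (-ᴹ A) ⊙ B ≋ -ᴹ (A ⊙ B)
  -ᴹ-⊙ (mat a b c d) (mat x y z w) = entry a b x z , entry a b y w , entry c d x z , entry c d y w
    where
    entry : ∀ x₁ x₂ y₁ y₂ → (- x₁) * y₁ + (- x₂) * y₂ ≈ - (x₁ * y₁ + x₂ * y₂)
    entry = solve 4 (λ x₁ x₂ y₁ y₂ → (:- x₁) :* y₁ :+ (:- x₂) :* y₂ := :- (x₁ :* y₁ :+ x₂ :* y₂)) refl

  ⊙-ᴹ : ∀ A B → A ⊙ (-ᴹ B) ≋ -ᴹ (A ⊙ B)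
  ⊙-ᴹ (mat a b c d) (mat x y z w) = entry a b x z , entry a b y w , entry c d x z , entry c d y w
    where
    entry : ∀ x₁ x₂ y₁ y₂ → x₁ * (- y₁) + x₂ * (- y₂) ≈ - (x₁ * y₁ + x₂ * y₂)
    entry = solve 4 (λ x₁ x₂ y₁ y₂ → x₁ :* (:- y₁) :+ x₂ :* (:- y₂) := :- (x₁ :* y₁ :+ x₂ :* y₂)) refl

  -ᴹ-involutive : ∀ A → -ᴹ (-ᴹ A) ≋ A
  -ᴹ-involutive A = ⁻¹-involutive _ , ⁻¹-involutive _ , ⁻¹-involutive _ , ⁻¹-involutive _

  det-cong : ∀ {A B} → A ≋ B → det F A ≈ det F B
  det-cong (a , b , c , d) = +-cong (*-cong a d) (-‿cong (*-cong b c))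

  det-• : ∀ s A → det F (s • A) ≈ s * s * det F A
  det-• s (mat a b c d) = solve 5 (λ s a b c d →
    s :* a :* (s :* d) :- s :* b :* (s :* c) := s :* s :* (a :* d :- b :* c)) refl s a b c d

  det-⊙ : ∀ A B → det F (A ⊙ B) ≈ det F A * det F B
  det-⊙ (mat a b c d) (mat x y z w) = solve 8 (λ a b c d x y z w →
    (a :* x :+ b :* z) :* (c :* y :+ d :* w) :- (a :* y :+ b :* w) :* (c :* x :+ d :* z) :=
    (a :* d :- b :* c) :* (x :* w :- y :* z)) refl a b c d x y z w

  •-⊙ : ∀ s t B C → (s • I ⊕ t • B) ⊙ C ≋ s • C ⊕ t • (B ⊙ C)
  •-⊙ s t (mat a b c d) (mat x y z w) = first s t a b x z , first s t a b y w , second s t c d x z , second s t c d y w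
    where
    first : ∀ s t a b x z → (s * 1# + t * a) * x + (s * 0# + t * b) * z ≈ s * x + t * (a * x + b * z)
    first = solve 6 (λ s t a b x z →
      (s :* con (+ 1) :+ t :* a) :* x :+ (s :* con (+ 0) :+ t :* b) :* z := s :* x :+ t :* (a :* x :+ b :* z)) refl
    second : ∀ s t c d x z → (s * 0# + t * c) * x + (s * 1# + t * d) * z ≈ s * z + t * (c * x + d * z)
    second = solve 6 (λ s t c d x z →
      (s :* con (+ 0) :+ t :* c) :* x :+ (s :* con (+ 1) :+ t :* d) :* z := s :* z :+ t :* (c :* x :+ d :* z)) refl

  -ᴹ-⊕ : ∀ s t A B → -ᴹ (s • A ⊕ t • B) ≋ (- s) • A ⊕ (- t) • B
  -ᴹ-⊕ s t A B = entry _ _ , entry _ _ , entry _ _ , entry _ _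
    where
    entry : ∀ x y → - (s * x + t * y) ≈ (- s) * x + (- t) * y
    entry x y = solve 4 (λ s t x y → :- (s :* x :+ t :* y) := (:- s) :* x :+ (:- t) :* y) refl s t x y

  ≈ᴾ-sym : ∀ {A B} → A ≈ᴾ B → B ≈ᴾ A
  ≈ᴾ-sym (inj₁ A≋B)  = inj₁ (≋-sym A≋B)
  ≈ᴾ-sym {A} {B} (inj₂ A≋-B) = inj₂ (≋-sym (≋-trans (-ᴹ-cong A≋-B) (-ᴹ-involutive B)))

  ≈ᴾ-trans : ∀ {A B C} → A ≈ᴾ B → B ≈ᴾ C → A ≈ᴾ C
  ≈ᴾ-trans (inj₁ A≋B)  (inj₁ B≋C)  = inj₁ (≋-trans A≋B B≋C)
  ≈ᴾ-trans (inj₁ A≋B)  (inj₂ B≋-C) = inj₂ (≋-trans A≋B B≋-C)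
  ≈ᴾ-trans (inj₂ A≋-B) (inj₁ B≋C)  = inj₂ (≋-trans A≋-B (-ᴹ-cong B≋C))
  ≈ᴾ-trans {C = C} (inj₂ A≋-B) (inj₂ B≋-C) =
    inj₁ (≋-trans A≋-B (≋-trans (-ᴹ-cong B≋-C) (-ᴹ-involutive C)))

  ≋⇒≈ᴾ : ∀ {A B} → A ≋ B → A ≈ᴾ B
  ≋⇒≈ᴾ = inj₁

  ≈ᴾ-⊙ : ∀ {A A′ B B′} → A ≈ᴾ A′ → B ≈ᴾ B′ → A ⊙ B ≈ᴾ A′ ⊙ B′
  ≈ᴾ-⊙ (inj₁ a) (inj₁ b) = inj₁ (⊙-cong a b)
  ≈ᴾ-⊙ {A′ = A′} {B′ = B′} (inj₁ a) (inj₂ b) = inj₂ (≋-trans (⊙-cong a b) (⊙-ᴹ A′ B′))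
  ≈ᴾ-⊙ {A′ = A′} {B′ = B′} (inj₂ a) (inj₁ b) = inj₂ (≋-trans (⊙-cong a b) (-ᴹ-⊙ A′ B′))
  ≈ᴾ-⊙ {A} {A′} {B} {B′} (inj₂ a) (inj₂ b) = inj₁ (begin
    A ⊙ B               ≈⟨ ⊙-cong a b ⟩
    (-ᴹ A′) ⊙ (-ᴹ B′)   ≈⟨ -ᴹ-⊙ A′ (-ᴹ B′) ⟩
    -ᴹ (A′ ⊙ (-ᴹ B′))   ≈⟨ -ᴹ-cong (⊙-ᴹ A′ B′) ⟩
    -ᴹ (-ᴹ (A′ ⊙ B′))   ≈⟨ -ᴹ-involutive _ ⟩
    A′ ⊙ B′             ∎)
    where open ≋-Reasoning

  Commute : M → M → Set ℓ
  Commute A B = A ⊙ B ≋ B ⊙ A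

  Anticommute : M → M → Set ℓ
  Anticommute A B = A ⊙ B ≋ -ᴹ (B ⊙ A)

  anticommute-sym : ∀ {A B} → Anticommute A B → Anticommute B A
  anticommute-sym {A} {B} AB≋-BA = ≋-sym (≋-trans (-ᴹ-cong AB≋-BA) (-ᴹ-involutive (B ⊙ A)))

  anticommute⇒commute-⊙ : ∀ {X A B} → Anticommute X A → Anticommute X B → Commute X (A ⊙ B)
  anticommute⇒commute-⊙ {X} {A} {B} XA≋-AX XB≋-BX = begin
    X ⊙ (A ⊙ B)         ≈⟨ ⊙-assoc X A B ⟨
    X ⊙ A ⊙ B           ≈⟨ ⊙-congʳ XA≋-AX ⟩
    (-ᴹ (A ⊙ X)) ⊙ B    ≈⟨ -ᴹ-⊙ (A ⊙ X) B ⟩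
    -ᴹ (A ⊙ X ⊙ B)      ≈⟨ -ᴹ-cong (⊙-assoc A X B) ⟩
    -ᴹ (A ⊙ (X ⊙ B))    ≈⟨ -ᴹ-cong (⊙-congˡ XB≋-BX) ⟩
    -ᴹ (A ⊙ -ᴹ (B ⊙ X)) ≈⟨ -ᴹ-cong (⊙-ᴹ A (B ⊙ X)) ⟩
    -ᴹ -ᴹ (A ⊙ (B ⊙ X)) ≈⟨ -ᴹ-involutive _ ⟩
    A ⊙ (B ⊙ X)         ≈⟨ ⊙-assoc A B X ⟨
    A ⊙ B ⊙ X           ∎
    where open ≋-Reasoning

  ⊙-square≈-I : ∀ {A} G → A ⊙ A ≋ -ᴹ I → G ⊙ A ⊙ A ≋ -ᴹ G
  ⊙-square≈-I {A} G AA≋-I = begin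
    G ⊙ A ⊙ A       ≈⟨ ⊙-assoc G A A ⟩
    G ⊙ (A ⊙ A)     ≈⟨ ⊙-congˡ AA≋-I ⟩
    G ⊙ -ᴹ I        ≈⟨ ⊙-ᴹ G I ⟩
    -ᴹ (G ⊙ I)      ≈⟨ -ᴹ-cong (⊙-identityʳ G) ⟩
    -ᴹ G            ∎
    where open ≋-Reasoning

  anticommute⇒conjugate : ∀ {A B} → A ⊙ A ≋ -ᴹ I → Anticommute A B → A ⊙ B ⊙ A ≋ B
  anticommute⇒conjugate {A} {B} AA≋-I AB≋-BA = begin
    A ⊙ B ⊙ A           ≈⟨ ⊙-assoc A B A ⟩
    A ⊙ (B ⊙ A)         ≈⟨ ⊙-congˡ (anticommute-sym AB≋-BA) ⟩
    A ⊙ -ᴹ (A ⊙ B)      ≈⟨ ⊙-ᴹ A (A ⊙ B) ⟩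
    -ᴹ (A ⊙ (A ⊙ B))    ≈⟨ -ᴹ-cong (⊙-assoc A A B) ⟨
    -ᴹ (A ⊙ A ⊙ B)      ≈⟨ -ᴹ-cong (⊙-congʳ AA≋-I) ⟩
    -ᴹ ((-ᴹ I) ⊙ B)     ≈⟨ -ᴹ-cong (-ᴹ-⊙ I B) ⟩
    -ᴹ -ᴹ (I ⊙ B)       ≈⟨ -ᴹ-involutive _ ⟩
    I ⊙ B               ≈⟨ ⊙-identityˡ B ⟩
    B                   ∎
    where open ≋-Reasoning

  commute-wordProd : ∀ {n} (g : Fin n → M) → (∀ i j → Commute (g i) (g j)) →
                     ∀ u w → Commute (wordProd F g u) (wordProd F g w)
  commute-wordProd g g-comm = words
    where
    W = wordProd F g

    letter-word : ∀ i w → Commute (g i) (W w)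
    letter-word i []      = ≋-trans (⊙-identityʳ (g i)) (≋-sym (⊙-identityˡ (g i)))
    letter-word i (j ∷ w) = begin
      g i ⊙ (g j ⊙ W w)   ≈⟨ ⊙-assoc (g i) (g j) (W w) ⟨
      g i ⊙ g j ⊙ W w     ≈⟨ ⊙-congʳ (g-comm i j) ⟩
      g j ⊙ g i ⊙ W w     ≈⟨ ⊙-assoc (g j) (g i) (W w) ⟩
      g j ⊙ (g i ⊙ W w)   ≈⟨ ⊙-congˡ (letter-word i w) ⟩
      g j ⊙ (W w ⊙ g i)   ≈⟨ ⊙-assoc (g j) (W w) (g i) ⟨
      g j ⊙ W w ⊙ g i     ∎
      where open ≋-Reasoning

    words : ∀ u w → Commute (W u) (W w)
    words []      w = ≋-trans (⊙-identityˡ (W w)) (≋-sym (⊙-identityʳ (W w)))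
    words (i ∷ u) w = begin
      g i ⊙ W u ⊙ W w     ≈⟨ ⊙-assoc (g i) (W u) (W w) ⟩
      g i ⊙ (W u ⊙ W w)   ≈⟨ ⊙-congˡ (words u w) ⟩
      g i ⊙ (W w ⊙ W u)   ≈⟨ ⊙-assoc (g i) (W w) (W u) ⟨
      g i ⊙ W w ⊙ W u     ≈⟨ ⊙-congʳ (letter-word i w) ⟩
      W w ⊙ g i ⊙ W u     ≈⟨ ⊙-assoc (W w) (g i) (W u) ⟩
      W w ⊙ (g i ⊙ W u)   ∎
      where open ≋-Reasoning

  transvections-do-not-commute : ¬ 1# ≈ 0# →
    ¬ (mat 1# 1# 0# 1# ⊙ mat 1# 0# 1# 1# ≈ᴾ mat 1# 0# 1# 1# ⊙ mat 1# 1# 0# 1#)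
  transvections-do-not-commute 1≉0 (inj₁ (e₁₁ , _)) = 1≉0 (≈-from-difference _
    (solve 0 (con (+ 1) :- con (+ 0) :=
      (con (+ 1) :* con (+ 1) :+ con (+ 1) :* con (+ 1)) :- (con (+ 1) :* con (+ 1) :+ con (+ 0) :* con (+ 0))) refl)
    (x-y≈0 e₁₁))
  transvections-do-not-commute 1≉0 (inj₂ (e₁₁ , e₁₂ , _)) = 1≉0 (≈-from-difference _
    (solve 0 (con (+ 1) :- con (+ 0) :=
      ((con (+ 1) :* con (+ 1) :+ con (+ 1) :* con (+ 1)) :- :- (con (+ 1) :* con (+ 1) :+ con (+ 0) :* con (+ 0)))
      :- ((con (+ 1) :* con (+ 0) :+ con (+ 1) :* con (+ 1)) :- :- (con (+ 1) :* con (+ 1) :+ con (+ 0) :* con (+ 1)))) refl)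
    (trans (+-cong (x-y≈0 e₁₁) (-‿cong (x-y≈0 e₁₂))) (trans (+-identityˡ _) ε⁻¹≈ε)))

  record Traceless : Set c where
    constructor traceless
    field x₁ x₂ x₃ : Carrier
  open Traceless public

  ⌜_⌝ : Traceless → M
  ⌜ X ⌝ = mat (x₁ X) (x₂ X) (x₃ X) (- x₁ X)

  -- On traceless matrices ⟨_,_⟩ is the polar form of -2 det, and
  -- X Y + Y X = ⟨ X , Y ⟩ I.
  ⟨_,_⟩ : M → M → Carrier
  ⟨ A , B ⟩ = two * (m₁₁ A * m₁₁ B) + m₁₂ A * m₂₁ B + m₂₁ A * m₁₂ B

  infix 4 _⟂_
  _⟂_ : Traceless → Traceless → Set ℓ
  X ⟂ Y = ⟨ ⌜ X ⌝ , ⌜ Y ⌝ ⟩ ≈ 0#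

  ⟨⟩-sym : ∀ A B → ⟨ A , B ⟩ ≈ ⟨ B , A ⟩
  ⟨⟩-sym A B = solve 6 (λ a₁ a₂ a₃ b₁ b₂ b₃ →
      con (+ 2) :* (a₁ :* b₁) :+ a₂ :* b₃ :+ a₃ :* b₂ :=
      con (+ 2) :* (b₁ :* a₁) :+ b₂ :* a₃ :+ b₃ :* a₂) refl
    (m₁₁ A) (m₁₂ A) (m₂₁ A) (m₁₁ B) (m₁₂ B) (m₂₁ B)

  ⟂-sym : ∀ {X Y} → X ⟂ Y → Y ⟂ X
  ⟂-sym {X} {Y} = trans (⟨⟩-sym ⌜ Y ⌝ ⌜ X ⌝)

  ⟨⟩-congʳ : ∀ A {B B′} → B ≋ B′ → ⟨ A , B ⟩ ≈ ⟨ A , B′ ⟩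
  ⟨⟩-congʳ A (b₁₁ , b₁₂ , b₂₁ , _) = +-cong (+-cong (*-congˡ (*-congˡ b₁₁)) (*-congˡ b₂₁)) (*-congˡ b₁₂)

  ⟨⟩-linearʳ : ∀ A s t B C → ⟨ A , s • B ⊕ t • C ⟩ ≈ s * ⟨ A , B ⟩ + t * ⟨ A , C ⟩
  ⟨⟩-linearʳ A s t B C = solve 11 (λ a₁ a₂ a₃ s t b₁ b₂ b₃ c₁ c₂ c₃ →
      con (+ 2) :* (a₁ :* (s :* b₁ :+ t :* c₁)) :+ a₂ :* (s :* b₃ :+ t :* c₃) :+ a₃ :* (s :* b₂ :+ t :* c₂)
      := s :* (con (+ 2) :* (a₁ :* b₁) :+ a₂ :* b₃ :+ a₃ :* b₂)
         :+ t :* (con (+ 2) :* (a₁ :* c₁) :+ a₂ :* c₃ :+ a₃ :* c₂)) refl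
    (m₁₁ A) (m₁₂ A) (m₂₁ A) s t (m₁₁ B) (m₁₂ B) (m₂₁ B) (m₁₁ C) (m₁₂ C) (m₂₁ C)

  ⟨⟩-negʳ : ∀ A B → ⟨ A , -ᴹ B ⟩ ≈ - ⟨ A , B ⟩
  ⟨⟩-negʳ A B = solve 6 (λ a₁ a₂ a₃ b₁ b₂ b₃ →
      con (+ 2) :* (a₁ :* (:- b₁)) :+ a₂ :* (:- b₃) :+ a₃ :* (:- b₂) :=
      :- (con (+ 2) :* (a₁ :* b₁) :+ a₂ :* b₃ :+ a₃ :* b₂)) refl
    (m₁₁ A) (m₁₂ A) (m₂₁ A) (m₁₁ B) (m₁₂ B) (m₂₁ B)

  ⟨⟩≈0-resp-≈ᴾ : ∀ A {B C} → B ≈ᴾ C → ⟨ A , B ⟩ ≈ 0# → ⟨ A , C ⟩ ≈ 0#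
  ⟨⟩≈0-resp-≈ᴾ A (inj₁ B≋C)  AB≈0 = trans (sym (⟨⟩-congʳ A B≋C)) AB≈0
  ⟨⟩≈0-resp-≈ᴾ A {B} {C} (inj₂ B≋-C) AB≈0 = begin
    ⟨ A , C ⟩            ≈⟨ ⁻¹-involutive _ ⟨
    - - ⟨ A , C ⟩        ≈⟨ -‿cong (⟨⟩-negʳ A C) ⟨
    - ⟨ A , -ᴹ C ⟩       ≈⟨ -‿cong (⟨⟩-congʳ A B≋-C) ⟨
    - ⟨ A , B ⟩          ≈⟨ -‿cong AB≈0 ⟩
    - 0#                 ≈⟨ ε⁻¹≈ε ⟩
    0#                   ∎
    where open import Relation.Binary.Reasoning.Setoid setoid

  unimodular⇒square≈-I : ∀ X → InSL2 F ⌜ X ⌝ → ⌜ X ⌝ ⊙ ⌜ X ⌝ ≋ -ᴹ I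
  unimodular⇒square≈-I (traceless x y z) det≈1 =
    ≈-from-difference _ (diagonal x y z) (y*x≈0 (- 1#) (x-y≈0 det≈1)) ,
    solve 2 (λ x y → x :* y :+ y :* (:- x) := :- con (+ 0)) refl x y ,
    solve 2 (λ x z → z :* x :+ (:- x) :* z := :- con (+ 0)) refl x z ,
    ≈-from-difference _ (diagonal′ x y z) (y*x≈0 (- 1#) (x-y≈0 det≈1))
    where
    diagonal : ∀ x y z → (x * x + y * z) - - 1# ≈ - 1# * (x * - x - y * z - 1#)
    diagonal = solve 3 (λ x y z →
      (x :* x :+ y :* z) :- (:- con (+ 1)) := (:- con (+ 1)) :* (x :* (:- x) :- y :* z :- con (+ 1))) refl
    diagonal′ : ∀ x y z → (z * y + - x * - x) - - 1# ≈ - 1# * (x * - x - y * z - 1#)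
    diagonal′ = solve 3 (λ x y z →
      (z :* y :+ (:- x) :* (:- x)) :- (:- con (+ 1)) := (:- con (+ 1)) :* (x :* (:- x) :- y :* z :- con (+ 1))) refl

  anticommute⇒⟂ : ∀ X Y → Anticommute ⌜ X ⌝ ⌜ Y ⌝ → X ⟂ Y
  anticommute⇒⟂ (traceless x₁ x₂ x₃) (traceless y₁ y₂ y₃) (e₁₁ , _) = trans
    (solve 6 (λ x₁ x₂ x₃ y₁ y₂ y₃ →
      con (+ 2) :* (x₁ :* y₁) :+ x₂ :* y₃ :+ x₃ :* y₂ :=
      (x₁ :* y₁ :+ x₂ :* y₃) :- (:- (y₁ :* x₁ :+ y₂ :* x₃))) refl x₁ x₂ x₃ y₁ y₂ y₃)
    (x-y≈0 e₁₁)

  ⟂⇒anticommute : ∀ X Y → X ⟂ Y → Anticommute ⌜ X ⌝ ⌜ Y ⌝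
  ⟂⇒anticommute (traceless x₁ x₂ x₃) (traceless y₁ y₂ y₃) X⟂Y =
    ≈-from-difference _
      (solve 6 (λ x₁ x₂ x₃ y₁ y₂ y₃ →
        (x₁ :* y₁ :+ x₂ :* y₃) :- (:- (y₁ :* x₁ :+ y₂ :* x₃)) :=
        con (+ 2) :* (x₁ :* y₁) :+ x₂ :* y₃ :+ x₃ :* y₂) refl x₁ x₂ x₃ y₁ y₂ y₃)
      X⟂Y ,
    solve 6 (λ x₁ x₂ x₃ y₁ y₂ y₃ → x₁ :* y₂ :+ x₂ :* (:- y₁) := :- (y₁ :* x₂ :+ y₂ :* (:- x₁))) refl x₁ x₂ x₃ y₁ y₂ y₃ ,
    solve 6 (λ x₁ x₂ x₃ y₁ y₂ y₃ → x₃ :* y₁ :+ (:- x₁) :* y₃ := :- (y₃ :* x₁ :+ (:- y₁) :* x₃)) refl x₁ x₂ x₃ y₁ y₂ y₃ ,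
    ≈-from-difference _
      (solve 6 (λ x₁ x₂ x₃ y₁ y₂ y₃ →
        (x₃ :* y₂ :+ (:- x₁) :* (:- y₁)) :- (:- (y₃ :* x₂ :+ (:- y₁) :* (:- x₁))) :=
        con (+ 2) :* (x₁ :* y₁) :+ x₂ :* y₃ :+ x₃ :* y₂) refl x₁ x₂ x₃ y₁ y₂ y₃)
      X⟂Y

  infixl 7 _×ᵗ_
  _×ᵗ_ : Traceless → Traceless → Traceless
  X ×ᵗ Y = traceless (m₁₁ XY) (m₁₂ XY) (m₂₁ XY)
    where XY = ⌜ X ⌝ ⊙ ⌜ Y ⌝

  ×ᵗ≋⊙ : ∀ X Y → X ⟂ Y → ⌜ X ×ᵗ Y ⌝ ≋ ⌜ X ⌝ ⊙ ⌜ Y ⌝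
  ×ᵗ≋⊙ (traceless x₁ x₂ x₃) (traceless y₁ y₂ y₃) X⟂Y = refl , refl , refl ,
    ≈-from-difference _
      (solve 6 (λ x₁ x₂ x₃ y₁ y₂ y₃ →
        (:- (x₁ :* y₁ :+ x₂ :* y₃)) :- (x₃ :* y₂ :+ (:- x₁) :* (:- y₁)) :=
        :- (con (+ 2) :* (x₁ :* y₁) :+ x₂ :* y₃ :+ x₃ :* y₂)) refl x₁ x₂ x₃ y₁ y₂ y₃)
      (trans (-‿cong X⟂Y) ε⁻¹≈ε)

  ×ᵗ-unimodular : ∀ X Y → InSL2 F ⌜ X ⌝ → InSL2 F ⌜ Y ⌝ → X ⟂ Y → InSL2 F ⌜ X ×ᵗ Y ⌝
  ×ᵗ-unimodular X Y detX≈1 detY≈1 X⟂Y = begin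
    det F ⌜ X ×ᵗ Y ⌝              ≈⟨ det-cong (×ᵗ≋⊙ X Y X⟂Y) ⟩
    det F (⌜ X ⌝ ⊙ ⌜ Y ⌝)         ≈⟨ det-⊙ ⌜ X ⌝ ⌜ Y ⌝ ⟩
    det F ⌜ X ⌝ * det F ⌜ Y ⌝     ≈⟨ *-cong detX≈1 detY≈1 ⟩
    1# * 1#                       ≈⟨ *-identityˡ 1# ⟩
    1#                            ∎
    where open import Relation.Binary.Reasoning.Setoid setoid

  ×ᵗ-⊙ˡ : ∀ X Y → InSL2 F ⌜ X ⌝ → X ⟂ Y → ⌜ X ×ᵗ Y ⌝ ⊙ ⌜ X ⌝ ≋ ⌜ Y ⌝
  ×ᵗ-⊙ˡ X Y detX≈1 X⟂Y = ≋-trans (⊙-congʳ (×ᵗ≋⊙ X Y X⟂Y))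
    (anticommute⇒conjugate (unimodular⇒square≈-I X detX≈1) (⟂⇒anticommute X Y X⟂Y))

  anticommute-×ᵗ : ∀ X Y → InSL2 F ⌜ X ⌝ → X ⟂ Y → Anticommute ⌜ X ⌝ ⌜ X ×ᵗ Y ⌝
  anticommute-×ᵗ X Y detX≈1 X⟂Y = begin
    ⌜ X ⌝ ⊙ ⌜ X ×ᵗ Y ⌝           ≈⟨ ⊙-congˡ (×ᵗ≋⊙ X Y X⟂Y) ⟩
    ⌜ X ⌝ ⊙ (⌜ X ⌝ ⊙ ⌜ Y ⌝)      ≈⟨ ⊙-assoc ⌜ X ⌝ ⌜ X ⌝ ⌜ Y ⌝ ⟨
    ⌜ X ⌝ ⊙ ⌜ X ⌝ ⊙ ⌜ Y ⌝        ≈⟨ ⊙-congʳ (unimodular⇒square≈-I X detX≈1) ⟩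
    (-ᴹ I) ⊙ ⌜ Y ⌝               ≈⟨ -ᴹ-⊙ I ⌜ Y ⌝ ⟩
    -ᴹ (I ⊙ ⌜ Y ⌝)               ≈⟨ -ᴹ-cong (⊙-identityˡ ⌜ Y ⌝) ⟩
    -ᴹ ⌜ Y ⌝                     ≈⟨ -ᴹ-cong (×ᵗ-⊙ˡ X Y detX≈1 X⟂Y) ⟨
    -ᴹ (⌜ X ×ᵗ Y ⌝ ⊙ ⌜ X ⌝)      ∎
    where open ≋-Reasoning

module OverField {c ℓ : Level} (F : CommutativeRing c ℓ) (isField : IsField F)
                 (_≟_ : ∀ x y → Dec (CommutativeRing._≈_ F x y)) where
  open CommutativeRing F hiding (zero)
  open IntegerCoefficientSolver F
  open MatrixAlgebra F
  open import Algebra.Properties.Group +-group using (ε⁻¹≈ε)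

  1≉0 : ¬ 1# ≈ 0#
  1≉0 = proj₁ isField

  cancelˡ : ∀ {x y} → ¬ x ≈ 0# → x * y ≈ 0# → y ≈ 0#
  cancelˡ {x} {y} x≉0 xy≈0 with proj₂ isField x x≉0
  ... | x⁻¹ , xx⁻¹≈1 = ≈-from-difference _
    (solve 3 (λ x y x⁻¹ → y :- con (+ 0) :=
      (:- y) :* (x :* x⁻¹ :- con (+ 1)) :+ x⁻¹ :* (x :* y :- con (+ 0))) refl x y x⁻¹)
    (x+y≈0 (y*x≈0 (- y) (x-y≈0 xx⁻¹≈1)) (y*x≈0 x⁻¹ (x-y≈0 xy≈0)))

  xy≈0⇒x≈0∨y≈0 : ∀ {x y} → x * y ≈ 0# → x ≈ 0# ⊎ y ≈ 0#
  xy≈0⇒x≈0∨y≈0 {x} xy≈0 with x ≟ 0#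
  ... | yes x≈0 = inj₁ x≈0
  ... | no  x≉0 = inj₂ (cancelˡ x≉0 xy≈0)

  x²≈1⇒x≈±1 : ∀ {x} → x * x ≈ 1# → x ≈ 1# ⊎ x ≈ - 1#
  x²≈1⇒x≈±1 {x} x²≈1 = by-factor (xy≈0⇒x≈0∨y≈0 (trans
    (solve 1 (λ x → (x :- con (+ 1)) :* (x :+ con (+ 1)) := x :* x :- con (+ 1)) refl x) (x-y≈0 x²≈1)))
    where
    by-factor : x - 1# ≈ 0# ⊎ x + 1# ≈ 0# → x ≈ 1# ⊎ x ≈ - 1#
    by-factor (inj₁ x-1≈0) = inj₁ (≈-from-difference _ refl x-1≈0)
    by-factor (inj₂ x+1≈0) = inj₂ (≈-from-difference _
      (solve 1 (λ x → x :- (:- con (+ 1)) := x :+ con (+ 1)) refl x) x+1≈0)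

  scalar-multiple⇒≈ᴾ : ∀ {A B s} → A ≋ s • B → InSL2 F A → InSL2 F B → A ≈ᴾ B
  scalar-multiple⇒≈ᴾ {A} {B} {s} A≋sB detA≈1 detB≈1 = by-sign (x²≈1⇒x≈±1 s²≈1)
    where
    s²≈1 : s * s ≈ 1#
    s²≈1 = begin
      s * s                 ≈⟨ *-identityʳ _ ⟨
      s * s * 1#            ≈⟨ *-congˡ detB≈1 ⟨
      s * s * det F B       ≈⟨ det-• s B ⟨
      det F (s • B)         ≈⟨ det-cong A≋sB ⟨
      det F A               ≈⟨ detA≈1 ⟩
      1#                    ∎
      where open import Relation.Binary.Reasoning.Setoid setoid
    by-sign : s ≈ 1# ⊎ s ≈ - 1# → A ≈ᴾ B
    by-sign (inj₁ s≈1)  = inj₁ (≋-trans A≋sB (entry , entry , entry , entry))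
      where
      entry : ∀ {x} → s * x ≈ x
      entry = trans (*-congʳ s≈1) (*-identityˡ _)
    by-sign (inj₂ s≈-1) = inj₂ (≋-trans A≋sB (entry , entry , entry , entry))
      where
      entry : ∀ {x} → s * x ≈ - x
      entry {x} = trans (*-congʳ s≈-1) (solve 1 (λ x → (:- con (+ 1)) :* x := :- x) refl x)

  involution⇒trace≈0 : ∀ A → InSL2 F A → A ⊙ A ≈ᴾ I → ¬ A ≈ᴾ I → trace A ≈ 0#
  involution⇒trace≈0 A@(mat a b c d) det≈1 A²≈ᴾI A≉ᴾI with trace A ≟ 0#
  ... | yes tr≈0 = tr≈0
  ... | no  tr≉0 = ⊥-elim (square (A²≈ᴾI))
    where
    -- entries (1,2) and (2,1) of A² are tr A times b and c
    b≈0 : a * b + b * d ≈ 0# → b ≈ 0#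
    b≈0 e = cancelˡ tr≉0 (trans (solve 3 (λ a b d → (a :+ d) :* b := a :* b :+ b :* d) refl a b d) e)
    c≈0 : c * a + d * c ≈ 0# → c ≈ 0#
    c≈0 e = cancelˡ tr≉0 (trans (solve 3 (λ a c d → (a :+ d) :* c := c :* a :+ d :* c) refl a c d) e)

    square : A ⊙ A ≈ᴾ I → ⊥
    square (inj₁ (e₁₁ , e₁₂ , e₂₁ , _)) = A≉ᴾI (scalar (x²≈1⇒x≈±1 a²≈1))
      where
      b≈0′ = b≈0 e₁₂
      d≈a : d ≈ a
      d≈a = ≈-from-difference _
        (solve 4 (λ a b c d → d :- a := (:- d) :* (a :* a :+ b :* c :- con (+ 1))
          :+ a :* (a :* d :- b :* c :- con (+ 1)) :+ (d :* c :+ a :* c) :* (b :- con (+ 0))) refl a b c d)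
        (x+y≈0 (x+y≈0 (y*x≈0 _ (x-y≈0 e₁₁)) (y*x≈0 _ (x-y≈0 det≈1))) (y*x≈0 _ (x-y≈0 b≈0′)))
      a²≈1 : a * a ≈ 1#
      a²≈1 = ≈-from-difference _
        (solve 3 (λ a b c → a :* a :- con (+ 1) :=
          (a :* a :+ b :* c :- con (+ 1)) :+ (:- c) :* (b :- con (+ 0))) refl a b c)
        (x+y≈0 (x-y≈0 e₁₁) (y*x≈0 _ (x-y≈0 b≈0′)))
      scalar : a ≈ 1# ⊎ a ≈ - 1# → A ≈ᴾ I
      scalar (inj₁ a≈1)  = inj₁ (a≈1 , b≈0′ , c≈0 e₂₁ , trans d≈a a≈1)
      scalar (inj₂ a≈-1) = inj₂ (a≈-1 , trans b≈0′ (sym ε⁻¹≈ε) , trans (c≈0 e₂₁) (sym ε⁻¹≈ε) , trans d≈a a≈-1)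
    square (inj₂ (e₁₁ , e₁₂ , _)) = 1≉0 (≈-from-difference _
      (solve 4 (λ a b c d → con (+ 1) :- con (+ 0) :=
        (:- con (+ 1)) :* (a :* d :- b :* c :- con (+ 1)) :+ d :* (a :- con (+ 0)) :+ (:- c) :* (b :- con (+ 0))) refl a b c d)
      (x+y≈0 (x+y≈0 (y*x≈0 _ (x-y≈0 det≈1)) (y*x≈0 _ (x-y≈0 a≈0))) (y*x≈0 _ (x-y≈0 b≈0′))))
      where
      b≈0′ = b≈0 (trans e₁₂ ε⁻¹≈ε)
      a≈0 : a ≈ 0#
      a≈0 = cancelˡ tr≉0 (≈-from-difference _
        (solve 4 (λ a b c d → (a :+ d) :* a :- con (+ 0) :=
          (a :* a :+ b :* c :- (:- con (+ 1))) :+ (a :* d :- b :* c :- con (+ 1))) refl a b c d)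
        (x+y≈0 (x-y≈0 e₁₁) (x-y≈0 det≈1)))

  traceless-part : M → Traceless
  traceless-part A = traceless (m₁₁ A) (m₁₂ A) (m₂₁ A)

  trace≈0⇒≋traceless-part : ∀ A → trace A ≈ 0# → A ≋ ⌜ traceless-part A ⌝
  trace≈0⇒≋traceless-part (mat a b c d) tr≈0 = refl , refl , refl , ≈-from-difference _
    (solve 2 (λ a d → d :- (:- a) := a :+ d) refl a d) tr≈0

  module OddCharacteristic (h : Carrier) (2h≈1 : two * h ≈ 1#) where

    -- α and β are read off from the traces of A = α I + β K and of A K = α K - β I.
    commute⇒span-I-K : ∀ A K → InSL2 F ⌜ K ⌝ → Commute A ⌜ K ⌝ →
                       A ≋ (h * trace A) • I ⊕ (- (h * trace (A ⊙ ⌜ K ⌝))) • ⌜ K ⌝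
    commute⇒span-I-K (mat m n o s) (traceless p q r) det≈1 (e₁₁ , e₁₂ , e₂₁ , e₂₂) =
      ≈-from-difference _
        (solve 8 (λ p q r m n o s h → m :- (h :* (m :+ s) :* con (+ 1) :+ (:- (h :* ((m :* p :+ n :* r) :+ (o :* q :+ s :* (:- p))))) :* p)
          := (:- m) :* (con (+ 2) :* h :- con (+ 1)) :+ (:- (h :* (m :- s))) :* (p :* (:- p) :- q :* r :- con (+ 1))
          :+ h :* p :* ((m :* p :+ n :* r) :- (p :* m :+ q :* o)) :+ h :* q :* ((o :* p :+ s :* r) :- (r :* m :+ (:- p) :* o))) refl p q r m n o s h)
        (x+y≈0 (x+y≈0 (x+y≈0 (y*x≈0 _ (x-y≈0 2h≈1)) (y*x≈0 _ (x-y≈0 det≈1))) (y*x≈0 _ (x-y≈0 e₁₁))) (y*x≈0 _ (x-y≈0 e₂₁))) ,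
      ≈-from-difference _
        (solve 8 (λ p q r m n o s h → n :- (h :* (m :+ s) :* con (+ 0) :+ (:- (h :* ((m :* p :+ n :* r) :+ (o :* q :+ s :* (:- p))))) :* q)
          := (:- n) :* (con (+ 2) :* h :- con (+ 1)) :+ (:- (con (+ 2) :* h :* n)) :* (p :* (:- p) :- q :* r :- con (+ 1))
          :+ h :* p :* ((m :* q :+ n :* (:- p)) :- (p :* n :+ q :* s)) :+ (:- (h :* q)) :* ((m :* p :+ n :* r) :- (p :* m :+ q :* o))) refl p q r m n o s h)
        (x+y≈0 (x+y≈0 (x+y≈0 (y*x≈0 _ (x-y≈0 2h≈1)) (y*x≈0 _ (x-y≈0 det≈1))) (y*x≈0 _ (x-y≈0 e₁₂))) (y*x≈0 _ (x-y≈0 e₁₁))) ,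
      ≈-from-difference _
        (solve 8 (λ p q r m n o s h → o :- (h :* (m :+ s) :* con (+ 0) :+ (:- (h :* ((m :* p :+ n :* r) :+ (o :* q :+ s :* (:- p))))) :* r)
          := (:- o) :* (con (+ 2) :* h :- con (+ 1)) :+ (:- (con (+ 2) :* h :* o)) :* (p :* (:- p) :- q :* r :- con (+ 1))
          :+ (:- (h :* p)) :* ((o :* p :+ s :* r) :- (r :* m :+ (:- p) :* o)) :+ h :* r :* ((m :* p :+ n :* r) :- (p :* m :+ q :* o))) refl p q r m n o s h)
        (x+y≈0 (x+y≈0 (x+y≈0 (y*x≈0 _ (x-y≈0 2h≈1)) (y*x≈0 _ (x-y≈0 det≈1))) (y*x≈0 _ (x-y≈0 e₂₁))) (y*x≈0 _ (x-y≈0 e₁₁))) ,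
      ≈-from-difference _
        (solve 8 (λ p q r m n o s h → s :- (h :* (m :+ s) :* con (+ 1) :+ (:- (h :* ((m :* p :+ n :* r) :+ (o :* q :+ s :* (:- p))))) :* (:- p))
          := h :* (m :- s) :* (p :* (:- p) :- q :* r :- con (+ 1)) :+ (:- (h :* p)) :* ((m :* p :+ n :* r) :- (p :* m :+ q :* o))
          :+ (:- (h :* q)) :* ((o :* p :+ s :* r) :- (r :* m :+ (:- p) :* o)) :+ (:- s) :* (con (+ 2) :* h :- con (+ 1))) refl p q r m n o s h)
        (x+y≈0 (x+y≈0 (x+y≈0 (y*x≈0 _ (x-y≈0 det≈1)) (y*x≈0 _ (x-y≈0 e₁₁))) (y*x≈0 _ (x-y≈0 e₂₁))) (y*x≈0 _ (x-y≈0 2h≈1)))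

    commute⇒≈ᴾ : ∀ X Y → InSL2 F ⌜ X ⌝ → InSL2 F ⌜ Y ⌝ → Commute ⌜ X ⌝ ⌜ Y ⌝ → ⌜ X ⌝ ≈ᴾ ⌜ Y ⌝
    commute⇒≈ᴾ X Y detX≈1 detY≈1 XY≋YX =
      scalar-multiple⇒≈ᴾ (≋-trans (commute⇒span-I-K ⌜ X ⌝ Y detY≈1 XY≋YX) (drop , drop , drop , drop)) detX≈1 detY≈1
      where
      α≈0 : h * trace ⌜ X ⌝ ≈ 0#
      α≈0 = y*x≈0 h (-‿inverseʳ (x₁ X))
      drop : ∀ {u v} → h * trace ⌜ X ⌝ * u + v ≈ v
      drop {u} {v} = trans (+-congʳ (trans (*-congʳ α≈0) (zeroˡ u))) (+-identityˡ v)

    ⟂-both⇒≈ᴾ-×ᵗ : ∀ X Y Z → InSL2 F ⌜ X ⌝ → InSL2 F ⌜ Y ⌝ → InSL2 F ⌜ Z ⌝ →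
                   X ⟂ Y → Z ⟂ X → Z ⟂ Y → ⌜ Z ⌝ ≈ᴾ ⌜ X ×ᵗ Y ⌝
    ⟂-both⇒≈ᴾ-×ᵗ X Y Z detX≈1 detY≈1 detZ≈1 X⟂Y Z⟂X Z⟂Y =
      commute⇒≈ᴾ Z (X ×ᵗ Y) detZ≈1 (×ᵗ-unimodular X Y detX≈1 detY≈1 X⟂Y) (begin
        ⌜ Z ⌝ ⊙ ⌜ X ×ᵗ Y ⌝           ≈⟨ ⊙-congˡ P≋XY ⟩
        ⌜ Z ⌝ ⊙ (⌜ X ⌝ ⊙ ⌜ Y ⌝)      ≈⟨ anticommute⇒commute-⊙ (⟂⇒anticommute Z X Z⟂X) (⟂⇒anticommute Z Y Z⟂Y) ⟩
        ⌜ X ⌝ ⊙ ⌜ Y ⌝ ⊙ ⌜ Z ⌝        ≈⟨ ⊙-congʳ P≋XY ⟨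
        ⌜ X ×ᵗ Y ⌝ ⊙ ⌜ Z ⌝           ∎)
      where
      open ≋-Reasoning
      P≋XY = ×ᵗ≋⊙ X Y X⟂Y

    ⟂-×ᵗ⇒span : ∀ X Y G → InSL2 F ⌜ X ⌝ → InSL2 F ⌜ Y ⌝ → X ⟂ Y → G ⟂ (X ×ᵗ Y) →
                Σ Carrier λ s → Σ Carrier λ t → ⌜ G ⌝ ≋ s • ⌜ X ⌝ ⊕ t • ⌜ Y ⌝
    ⟂-×ᵗ⇒span X Y G detX≈1 detY≈1 X⟂Y G⟂P = - α , - β , (begin
      ⌜ G ⌝                                      ≈⟨ -ᴹ-involutive ⌜ G ⌝ ⟨
      -ᴹ -ᴹ ⌜ G ⌝                                ≈⟨ -ᴹ-cong (⊙-square≈-I ⌜ G ⌝ (unimodular⇒square≈-I X detX≈1)) ⟨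
      -ᴹ (⌜ G ⌝ ⊙ ⌜ X ⌝ ⊙ ⌜ X ⌝)                 ≈⟨ -ᴹ-cong (⊙-congʳ GX≋αI+βP) ⟩
      -ᴹ ((α • I ⊕ β • ⌜ P ⌝) ⊙ ⌜ X ⌝)           ≈⟨ -ᴹ-cong (•-⊙ α β ⌜ P ⌝ ⌜ X ⌝) ⟩
      -ᴹ (α • ⌜ X ⌝ ⊕ β • (⌜ P ⌝ ⊙ ⌜ X ⌝))        ≈⟨ -ᴹ-cong (⊕-cong ≋-refl (•-cong refl (×ᵗ-⊙ˡ X Y detX≈1 X⟂Y))) ⟩
      -ᴹ (α • ⌜ X ⌝ ⊕ β • ⌜ Y ⌝)                 ≈⟨ -ᴹ-⊕ α β ⌜ X ⌝ ⌜ Y ⌝ ⟩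
      (- α) • ⌜ X ⌝ ⊕ (- β) • ⌜ Y ⌝              ∎)
      where
      open ≋-Reasoning
      P  = X ×ᵗ Y
      GX = ⌜ G ⌝ ⊙ ⌜ X ⌝
      α  = h * trace GX
      β  = - (h * trace (GX ⊙ ⌜ P ⌝))
      GX≋αI+βP : GX ≋ α • I ⊕ β • ⌜ P ⌝
      GX≋αI+βP = commute⇒span-I-K GX P (×ᵗ-unimodular X Y detX≈1 detY≈1 X⟂Y) (≋-sym
        (anticommute⇒commute-⊙ (⟂⇒anticommute P G (⟂-sym G⟂P))
                               (anticommute-sym (anticommute-×ᵗ X Y detX≈1 X⟂Y))))

    -- With ρ₀, ρ₂, ρ₄ pairwise orthogonal, ρ₄ = ± ρ₀ ρ₂; then ρ₁ ⟂ ρ₄ puts ρ₁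
    -- in the span of ρ₀ and ρ₂, and ρ₃ ⟂ ρ₀, ρ₁ forces ρ₁ = ± ρ₀ or ρ₃ ⟂ ρ₂,
    -- i.e. ρ₃ = ± ρ₄.
    string-of-five : ∀ {m} (ρ : Fin (5 ℕ.+ m) → Traceless) → (∀ i → InSL2 F ⌜ ρ i ⌝) →
                     (∀ i j → toℕ i ℕ.+ 2 ≤ toℕ j → ρ i ⟂ ρ j) →
                     ⌜ ρ (# 1) ⌝ ≈ᴾ ⌜ ρ (# 0) ⌝ ⊎ ⌜ ρ (# 3) ⌝ ≈ᴾ ⌜ ρ (# 4) ⌝
    string-of-five ρ unimodular far⇒⟂ = conclude (⟂-×ᵗ⇒span ρ₀ ρ₂ ρ₁ (unimodular _) (unimodular _) ρ₀⟂ρ₂ ρ₁⟂P)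
      where
      ⟂! : ∀ i j → {True (toℕ i ℕ.+ 2 ℕ.≤? toℕ j)} → ρ i ⟂ ρ j
      ⟂! i j {i+2≤j} = far⇒⟂ i j (toWitness i+2≤j)

      ρ₀ = ρ (# 0); ρ₁ = ρ (# 1); ρ₂ = ρ (# 2); ρ₃ = ρ (# 3); ρ₄ = ρ (# 4)
      P  = ρ₀ ×ᵗ ρ₂

      ρ₀⟂ρ₂ : ρ₀ ⟂ ρ₂
      ρ₀⟂ρ₂ = ⟂! (# 0) (# 2)

      ⟂ρ₀-and-ρ₂⇒≈ᴾP : ∀ i → ρ i ⟂ ρ₀ → ρ i ⟂ ρ₂ → ⌜ ρ i ⌝ ≈ᴾ ⌜ P ⌝
      ⟂ρ₀-and-ρ₂⇒≈ᴾP i = ⟂-both⇒≈ᴾ-×ᵗ ρ₀ ρ₂ (ρ i) (unimodular _) (unimodular _) (unimodular i) ρ₀⟂ρ₂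

      ρ₄≈ᴾP : ⌜ ρ₄ ⌝ ≈ᴾ ⌜ P ⌝
      ρ₄≈ᴾP = ⟂ρ₀-and-ρ₂⇒≈ᴾP (# 4) (⟂-sym (⟂! (# 0) (# 4))) (⟂-sym (⟂! (# 2) (# 4)))

      ρ₁⟂P : ρ₁ ⟂ P
      ρ₁⟂P = ⟨⟩≈0-resp-≈ᴾ ⌜ ρ₁ ⌝ ρ₄≈ᴾP (⟂! (# 1) (# 4))

      conclude : Σ Carrier (λ s → Σ Carrier λ t → ⌜ ρ₁ ⌝ ≋ s • ⌜ ρ₀ ⌝ ⊕ t • ⌜ ρ₂ ⌝) →
                 ⌜ ρ₁ ⌝ ≈ᴾ ⌜ ρ₀ ⌝ ⊎ ⌜ ρ₃ ⌝ ≈ᴾ ⌜ ρ₄ ⌝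
      conclude (s , t , ρ₁≋sρ₀+tρ₂) with t ≟ 0#
      ... | yes t≈0 = inj₁ (scalar-multiple⇒≈ᴾ (≋-trans ρ₁≋sρ₀+tρ₂ (drop , drop , drop , drop))
                                              (unimodular _) (unimodular _))
        where
        drop : ∀ {u v} → s * u + t * v ≈ s * u
        drop {u} {v} = trans (+-congˡ (trans (*-congʳ t≈0) (zeroˡ v))) (+-identityʳ _)
      ... | no  t≉0 = inj₂ (≈ᴾ-trans (⟂ρ₀-and-ρ₂⇒≈ᴾP (# 3) (⟂-sym (⟂! (# 0) (# 3))) ρ₃⟂ρ₂) (≈ᴾ-sym ρ₄≈ᴾP))
        where
        open import Relation.Binary.Reasoning.Setoid setoid
        ρ₃⟂ρ₂ : ρ₃ ⟂ ρ₂
        ρ₃⟂ρ₂ = cancelˡ t≉0 (begin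
          t * ⟨ ⌜ ρ₃ ⌝ , ⌜ ρ₂ ⌝ ⟩                                ≈⟨ +-identityˡ _ ⟨
          0# + t * ⟨ ⌜ ρ₃ ⌝ , ⌜ ρ₂ ⌝ ⟩                           ≈⟨ +-congʳ (y*x≈0 s (⟂-sym (⟂! (# 0) (# 3)))) ⟨
          s * ⟨ ⌜ ρ₃ ⌝ , ⌜ ρ₀ ⌝ ⟩ + t * ⟨ ⌜ ρ₃ ⌝ , ⌜ ρ₂ ⌝ ⟩      ≈⟨ ⟨⟩-linearʳ ⌜ ρ₃ ⌝ s t ⌜ ρ₀ ⌝ ⌜ ρ₂ ⌝ ⟨
          ⟨ ⌜ ρ₃ ⌝ , s • ⌜ ρ₀ ⌝ ⊕ t • ⌜ ρ₂ ⌝ ⟩                   ≈⟨ ⟨⟩-congʳ ⌜ ρ₃ ⌝ ρ₁≋sρ₀+tρ₂ ⟨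
          ⟨ ⌜ ρ₃ ⌝ , ⌜ ρ₁ ⌝ ⟩                                    ≈⟨ ⟂-sym (⟂! (# 1) (# 3)) ⟩
          0#                                                     ∎)

  infix 4 _∥_
  _∥_ : Traceless → Traceless → Set ℓ
  X ∥ Y = x₂ X * x₃ Y ≈ x₃ X * x₂ Y

  NonDiagonal : Traceless → Set ℓ
  NonDiagonal X = ¬ (x₂ X ≈ 0# × x₃ X ≈ 0#)

  ∥-refl : ∀ X → X ∥ X
  ∥-refl X = *-comm _ _

  ∥-sym : ∀ X Y → X ∥ Y → Y ∥ X
  ∥-sym _ _ X∥Y = trans (*-comm _ _) (trans (sym X∥Y) (*-comm _ _))

  ∥-trans : ∀ V W U → NonDiagonal V → V ∥ W → V ∥ U → W ∥ U
  ∥-trans (traceless v₁ v₂ v₃) (traceless w₁ w₂ w₃) (traceless u₁ u₂ u₃) V≠diag V∥W V∥U =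
    ≈-from-difference _ refl (D≈0 (xy≈0⇒x≈0∨y≈0 v₂D≈0) (xy≈0⇒x≈0∨y≈0 v₃D≈0))
    where
    D = w₂ * u₃ - w₃ * u₂
    v₂D≈0 : v₂ * D ≈ 0#
    v₂D≈0 = trans
      (solve 6 (λ v₂ v₃ w₂ w₃ u₂ u₃ → v₂ :* (w₂ :* u₃ :- w₃ :* u₂) :=
        w₂ :* (v₂ :* u₃ :- v₃ :* u₂) :+ (:- u₂) :* (v₂ :* w₃ :- v₃ :* w₂)) refl v₂ v₃ w₂ w₃ u₂ u₃)
      (x+y≈0 (y*x≈0 w₂ (x-y≈0 V∥U)) (y*x≈0 (- u₂) (x-y≈0 V∥W)))
    v₃D≈0 : v₃ * D ≈ 0#
    v₃D≈0 = trans
      (solve 6 (λ v₂ v₃ w₂ w₃ u₂ u₃ → v₃ :* (w₂ :* u₃ :- w₃ :* u₂) :=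
        w₃ :* (v₂ :* u₃ :- v₃ :* u₂) :+ (:- u₃) :* (v₂ :* w₃ :- v₃ :* w₂)) refl v₂ v₃ w₂ w₃ u₂ u₃)
      (x+y≈0 (y*x≈0 w₃ (x-y≈0 V∥U)) (y*x≈0 (- u₃) (x-y≈0 V∥W)))
    D≈0 : v₂ ≈ 0# ⊎ D ≈ 0# → v₃ ≈ 0# ⊎ D ≈ 0# → D ≈ 0#
    D≈0 (inj₂ D≈0) _           = D≈0
    D≈0 (inj₁ _)   (inj₂ D≈0)  = D≈0
    D≈0 (inj₁ v₂≈0) (inj₁ v₃≈0) = ⊥-elim (V≠diag (v₂≈0 , v₃≈0))

  module EvenCharacteristic (2≈0 : two ≈ 0#) where

    -1≈1 : - 1# ≈ 1#
    -1≈1 = ≈-from-difference _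
      (solve 0 (:- con (+ 1) :- con (+ 1) := (:- con (+ 1)) :* con (+ 2)) refl)
      (y*x≈0 (- 1#) 2≈0)

    commute-in-PSL⇒∥ : ∀ X Y → ⌜ X ⌝ ⊙ ⌜ Y ⌝ ≈ᴾ ⌜ Y ⌝ ⊙ ⌜ X ⌝ → X ∥ Y
    commute-in-PSL⇒∥ (traceless x₁ x₂ x₃) (traceless y₁ y₂ y₃) (inj₁ (e₁₁ , _)) = ≈-from-difference _
      (solve 6 (λ x₁ x₂ x₃ y₁ y₂ y₃ → x₂ :* y₃ :- x₃ :* y₂ :=
        (x₁ :* y₁ :+ x₂ :* y₃) :- (y₁ :* x₁ :+ y₂ :* x₃)) refl x₁ x₂ x₃ y₁ y₂ y₃)
      (x-y≈0 e₁₁)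
    commute-in-PSL⇒∥ (traceless x₁ x₂ x₃) (traceless y₁ y₂ y₃) (inj₂ (e₁₁ , _)) = ≈-from-difference _
      (solve 6 (λ x₁ x₂ x₃ y₁ y₂ y₃ → x₂ :* y₃ :- x₃ :* y₂ :=
        ((x₁ :* y₁ :+ x₂ :* y₃) :- (:- (y₁ :* x₁ :+ y₂ :* x₃)))
        :+ (:- (x₁ :* y₁ :+ x₃ :* y₂)) :* con (+ 2)) refl x₁ x₂ x₃ y₁ y₂ y₃)
      (x+y≈0 (x-y≈0 e₁₁) (y*x≈0 _ 2≈0))

    ∥⇒commute : ∀ X Y → X ∥ Y → Commute ⌜ X ⌝ ⌜ Y ⌝
    ∥⇒commute (traceless x₁ x₂ x₃) (traceless y₁ y₂ y₃) X∥Y =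
      ≈-from-difference _
        (solve 6 (λ x₁ x₂ x₃ y₁ y₂ y₃ →
          (x₁ :* y₁ :+ x₂ :* y₃) :- (y₁ :* x₁ :+ y₂ :* x₃) := x₂ :* y₃ :- x₃ :* y₂) refl x₁ x₂ x₃ y₁ y₂ y₃)
        (x-y≈0 X∥Y) ,
      ≈-from-difference _
        (solve 6 (λ x₁ x₂ x₃ y₁ y₂ y₃ →
          (x₁ :* y₂ :+ x₂ :* (:- y₁)) :- (y₁ :* x₂ :+ y₂ :* (:- x₁)) :=
          (x₁ :* y₂ :- x₂ :* y₁) :* con (+ 2)) refl x₁ x₂ x₃ y₁ y₂ y₃)
        (y*x≈0 _ 2≈0) ,
      ≈-from-difference _
        (solve 6 (λ x₁ x₂ x₃ y₁ y₂ y₃ →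
          (x₃ :* y₁ :+ (:- x₁) :* y₃) :- (y₃ :* x₁ :+ (:- y₁) :* x₃) :=
          (x₃ :* y₁ :- x₁ :* y₃) :* con (+ 2)) refl x₁ x₂ x₃ y₁ y₂ y₃)
        (y*x≈0 _ 2≈0) ,
      ≈-from-difference _
        (solve 6 (λ x₁ x₂ x₃ y₁ y₂ y₃ →
          (x₃ :* y₂ :+ (:- x₁) :* (:- y₁)) :- (y₃ :* x₂ :+ (:- y₁) :* (:- x₁)) :=
          (:- con (+ 1)) :* (x₂ :* y₃ :- x₃ :* y₂)) refl x₁ x₂ x₃ y₁ y₂ y₃)
        (y*x≈0 _ (x-y≈0 X∥Y))

    involution⇒nondiagonal : ∀ X → InSL2 F ⌜ X ⌝ → ¬ ⌜ X ⌝ ≈ᴾ I → NonDiagonal X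
    involution⇒nondiagonal (traceless x₁ x₂ x₃) det≈1 X≉ᴾI (x₂≈0 , x₃≈0) = X≉ᴾI (scalar (x²≈1⇒x≈±1 x₁²≈1))
      where
      x₁²≈1 : x₁ * x₁ ≈ 1#
      x₁²≈1 = ≈-from-difference _
        (solve 3 (λ x₁ x₂ x₃ → x₁ :* x₁ :- con (+ 1) :=
          (:- con (+ 1)) :* (x₁ :* (:- x₁) :- x₂ :* x₃ :- con (+ 1)) :+ (:- x₃) :* x₂
          :+ (:- con (+ 1)) :* con (+ 2)) refl x₁ x₂ x₃)
        (x+y≈0 (x+y≈0 (y*x≈0 _ (x-y≈0 det≈1)) (y*x≈0 _ x₂≈0)) (y*x≈0 _ 2≈0))
      scalar : x₁ ≈ 1# ⊎ x₁ ≈ - 1# → ⌜ traceless x₁ x₂ x₃ ⌝ ≈ᴾ I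
      scalar (inj₁ x₁≈1)  = inj₁ (x₁≈1 , x₂≈0 , x₃≈0 , trans (-‿cong x₁≈1) -1≈1)
      scalar (inj₂ x₁≈-1) = inj₂ (x₁≈-1 , trans x₂≈0 (sym ε⁻¹≈ε) , trans x₃≈0 (sym ε⁻¹≈ε) ,
                                  trans (-‿cong x₁≈-1) (-‿cong -1≈1))

    -- ρ₀ and ρ₁ are linked through ρ₃, every other ρᵢ is far from ρ₀.
    string⇒all-∥ : ∀ {m} (ρ : Fin (4 ℕ.+ m) → Traceless) → (∀ i → NonDiagonal (ρ i)) →
                   (∀ i j → toℕ i ℕ.+ 2 ≤ toℕ j → ρ i ∥ ρ j) → ∀ i j → ρ i ∥ ρ j
    string⇒all-∥ ρ nondiagonal far⇒∥ i j = ∥-trans (ρ zero) (ρ i) (ρ j) (nondiagonal zero) (ρ₀∥ i) (ρ₀∥ j)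
      where
      ρ₀∥ : ∀ i → ρ zero ∥ ρ i
      ρ₀∥ zero          = ∥-refl (ρ zero)
      ρ₀∥ (suc zero)    = ∥-trans (ρ (# 3)) (ρ zero) (ρ (# 1)) (nondiagonal (# 3))
                            (∥-sym (ρ zero) (ρ (# 3)) (far⇒∥ (# 0) (# 3) (s≤s (s≤s z≤n))))
                            (∥-sym (ρ (# 1)) (ρ (# 3)) (far⇒∥ (# 1) (# 3) (s≤s (s≤s (s≤s z≤n)))))
      ρ₀∥ (suc (suc i)) = far⇒∥ zero (suc (suc i)) (s≤s (s≤s z≤n))

  module _ {m : ℕ} (ρ : StringRep F (5 ℕ.+ m)) where
    open StringRep ρ

    T : Fin (5 ℕ.+ m) → Traceless
    T i = traceless-part (gen i)

    gen≋T : ∀ i → gen i ≋ ⌜ T i ⌝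
    gen≋T i = trace≈0⇒≋traceless-part (gen i)
      (involution⇒trace≈0 (gen i) (gen-SL2 i) (involution i) (nontrivial i))

    T-unimodular : ∀ i → InSL2 F ⌜ T i ⌝
    T-unimodular i = trans (det-cong (≋-sym (gen≋T i))) (gen-SL2 i)

    T-nontrivial : ∀ i → ¬ ⌜ T i ⌝ ≈ᴾ I
    T-nontrivial i Tᵢ≈ᴾI = nontrivial i (≈ᴾ-trans (≋⇒≈ᴾ (gen≋T i)) Tᵢ≈ᴾI)

    T-distinct : ∀ i j → ⌜ T i ⌝ ≈ᴾ ⌜ T j ⌝ → i ≡ j
    T-distinct i j Tᵢ≈ᴾTⱼ = distinct i j
      (≈ᴾ-trans (≋⇒≈ᴾ (gen≋T i)) (≈ᴾ-trans Tᵢ≈ᴾTⱼ (≋⇒≈ᴾ (≋-sym (gen≋T j)))))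

    T-indices-differ : ∀ {i j} → toℕ i ≢ toℕ j → ¬ ⌜ T i ⌝ ≈ᴾ ⌜ T j ⌝
    T-indices-differ toℕi≢toℕj Tᵢ≈ᴾTⱼ = toℕi≢toℕj (≡.cong toℕ (T-distinct _ _ Tᵢ≈ᴾTⱼ))

    T-string : ∀ i j → toℕ i ℕ.+ 2 ≤ toℕ j → ⌜ T i ⌝ ⊙ ⌜ T j ⌝ ≈ᴾ ⌜ T j ⌝ ⊙ ⌜ T i ⌝
    T-string i j i+2≤j = ≈ᴾ-trans (≋⇒≈ᴾ (⊙-cong (≋-sym (gen≋T i)) (≋-sym (gen≋T j))))
      (≈ᴾ-trans (string i j i+2≤j) (≋⇒≈ᴾ (⊙-cong (gen≋T j) (gen≋T i))))

    module _ (h : Carrier) (2h≈1 : two * h ≈ 1#) where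
      open OddCharacteristic h 2h≈1

      T-far⇒⟂ : ∀ i j → toℕ i ℕ.+ 2 ≤ toℕ j → T i ⟂ T j
      T-far⇒⟂ i j i+2≤j = by-cases (T-string i j i+2≤j)
        where
        by-cases : ⌜ T i ⌝ ⊙ ⌜ T j ⌝ ≈ᴾ ⌜ T j ⌝ ⊙ ⌜ T i ⌝ → T i ⟂ T j
        by-cases (inj₂ anticommute) = anticommute⇒⟂ (T i) (T j) anticommute
        by-cases (inj₁ commute)     = ⊥-elim (ℕ.m+1+n≰m (toℕ i)
          (≡.subst (λ k → toℕ i ℕ.+ 2 ≤ toℕ k) (≡.sym i≡j) i+2≤j))
          where
          i≡j : i ≡ j
          i≡j = T-distinct i j (commute⇒≈ᴾ (T i) (T j) (T-unimodular i) (T-unimodular j) commute)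

      odd-impossible : ⊥
      odd-impossible = by-cases (string-of-five T T-unimodular T-far⇒⟂)
        where
        by-cases : ⌜ T (# 1) ⌝ ≈ᴾ ⌜ T (# 0) ⌝ ⊎ ⌜ T (# 3) ⌝ ≈ᴾ ⌜ T (# 4) ⌝ → ⊥
        by-cases (inj₁ T₁≈ᴾT₀) = T-indices-differ (λ ()) T₁≈ᴾT₀
        by-cases (inj₂ T₃≈ᴾT₄) = T-indices-differ (λ ()) T₃≈ᴾT₄

    even-impossible : two ≈ 0# → ⊥
    even-impossible 2≈0 = transvections-do-not-commute 1≉0 (≈ᴾ-trans (≈ᴾ-sym (≈ᴾ-⊙ wX≈ᴾX wY≈ᴾY))
      (≈ᴾ-trans (≋⇒≈ᴾ (commute-wordProd gen gen-commute wX wY)) (≈ᴾ-⊙ wY≈ᴾY wX≈ᴾX)))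
      where
      open EvenCharacteristic 2≈0
      T-∥ : ∀ i j → T i ∥ T j
      T-∥ = string⇒all-∥ T (λ i → involution⇒nondiagonal (T i) (T-unimodular i) (T-nontrivial i))
                           (λ i j i+2≤j → commute-in-PSL⇒∥ (T i) (T j) (T-string i j i+2≤j))
      gen-commute : ∀ i j → Commute (gen i) (gen j)
      gen-commute i j = ≋-trans (⊙-cong (gen≋T i) (gen≋T j))
        (≋-trans (∥⇒commute (T i) (T j) (T-∥ i j)) (⊙-cong (≋-sym (gen≋T j)) (≋-sym (gen≋T i))))
      X = mat 1# 1# 0# 1#
      Y = mat 1# 0# 1# 1#
      X-unimodular : InSL2 F X
      X-unimodular = solve 0 (con (+ 1) :* con (+ 1) :- con (+ 1) :* con (+ 0) := con (+ 1)) refl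
      Y-unimodular : InSL2 F Y
      Y-unimodular = solve 0 (con (+ 1) :* con (+ 1) :- con (+ 0) :* con (+ 1) := con (+ 1)) refl
      wX = proj₁ (generates X X-unimodular)
      wX≈ᴾX = proj₂ (generates X X-unimodular)
      wY = proj₁ (generates Y Y-unimodular)
      wY≈ᴾY = proj₂ (generates Y Y-unimodular)

    no-string-representation : ⊥
    no-string-representation with two ≟ 0#
    ... | yes 2≈0 = even-impossible 2≈0
    ... | no  2≉0 = let h , 2h≈1 = proj₂ isField two 2≉0 in odd-impossible h 2h≈1

module _ {c ℓ : Level} (F : CommutativeRing c ℓ) where
  open CommutativeRing F

  finite⇒≈-decidable : ∀ {q} → HasSize F q → ∀ x y → Dec (x ≈ y)
  finite⇒≈-decidable (f , f-injective , f-surjective) x y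
    with f-surjective x | f-surjective y
  ... | i , fi≈x | j , fj≈y with i Fin.≟ j
  ...   | yes ≡.refl = yes (trans (sym fi≈x) fj≈y)
  ...   | no  i≢j    = no λ x≈y → i≢j (f-injective i j (trans fi≈x (trans x≈y (sym fj≈y))))

mainTheorem1 : {c ℓ : Level} (q : ℕ) → IsPrimePower q →
               (F : CommutativeRing c ℓ) → IsField F → HasSize F q →
               (n : ℕ) → 5 ≤ n → ¬ StringRep F n
mainTheorem1 q _ F isField size _ (s≤s (s≤s (s≤s (s≤s (s≤s _))))) =
  OverField.no-string-representation F isField (finite⇒≈-decidable F size)
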